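{- Let $G=(V,E)$ be a graph, $\mathcal{C}_G\subseteq 2^V$ a feasible family, and $(\mathcal{T}=(I,F),\{X_i\}_{i\in I})$ a rooted binary tree decomposition of $G$ with root $r$, together with $\Sigma_i$, $\mathcal{H}_{i,\sigma}$, $X_{i,\sigma}$, $\mathcal{F}_{i,\sigma}$ satisfying conditions (1)–(4) described in the context. Then for any $S\in\mathcal{C}_G$ there is a collection $\{b(i)\in\Sigma_i\}_{i\in I}$ such that: for each node $i$ with children $j,j'$, $(b(j),b(j'))\in\mathcal{F}_{i,b(i)}$; for each leaf $\ell$, $\mathcal{H}_{\ell,b(\ell)}\neq\emptyset$; and $S=\bigcup_{i\in I}X_{i,b(i)}$. Moreover, for any vertex $u\in V$, if $\bar u\in I$ denotes the highest (closest to the root) node whose bag contains $u$, then $u\in S$ if and only if $u\in X_{\bar u,b(\bar u)}$.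
   Context: Tree decomposition: tree $\mathcal{T}=(I,F)$ with bags $X_i\subseteq V$ such that for each $v$ the nodes containing $v$ form a connected subtree and each edge of $G$ lies in some bag; $V_i$ is the union of bags in the subtree rooted at $i$; children of a non-leaf $i$ are denoted $j,j'$. Data: for each node $i$ a finite state set $\Sigma_i$; for each $\sigma\in\Sigma_i$ a collection $\mathcal{H}_{i,\sigma}\subseteq 2^{V_i}$; for non-leaf $i$ and $\sigma\in\Sigma_i$ a set $\mathcal{F}_{i,\sigma}\subseteq\Sigma_j\times\Sigma_{j'}$. Conditions: (1) $|\Sigma_i|$ and $|\mathcal{F}_{i,\sigma}|$ are bounded by constants; (2) for each $i,\sigma$ there is $X_{i,\sigma}$ with $S\cap X_i=X_{i,\sigma}$ for all $S\in\mathcal{H}_{i,\sigma}$; (3) for non-leaf $i$, $\mathcal{H}_{i,\sigma}=\{X_{i,\sigma}\cup S_j\cup S_{j'}: S_j\in\mathcal{H}_{j,w_j}, S_{j'}\in\mathcal{H}_{j',w_{j'}}, (w_j,w_{j'})\in\mathcal{F}_{i,\sigma}\}$, and for a leaf $\ell$, $\mathcal{H}_{\ell,\sigma}\in\{\{X_{\ell,\sigma}\},\emptyset\}$; (4) $\mathcal{C}_G=\bigcup_{\sigma\in\Sigma_r}\mathcal{H}_{r,\sigma}$. -}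

module Defs where

open import Data.Nat using (ℕ; zero; suc; _≤_)
open import Data.Fin using (Fin)
open import Data.Fin.Subset using (Subset; _∈_; _∪_; _∩_)
open import Data.Product using (Σ; ∃; ∃-syntax; _×_; _,_; proj₁; proj₂)
open import Data.Sum using (_⊎_)
open import Relation.Nullary using (¬_)
open import Relation.Binary.PropositionalEquality using (_≡_)
open import Function.Bundles using (_⇔_)

data BTree : Set where
  leaf : BTree
  node : BTree → BTree → BTree

-- Pos t s : a node of t (given as the path from the root) whose subtree is s.
data Pos : BTree → BTree → Set where
  here  : ∀ {t} → Pos t t
  left  : ∀ {l r s} → Pos l s → Pos (node l r) s
  right : ∀ {l r s} → Pos r s → Pos (node l r) s

Node : BTree → Set
Node t = Σ BTree (Pos t)

ext : ∀ {t s u} → Pos t s → Pos s u → Pos t u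
ext here      w = w
ext (left p)  w = left (ext p w)
ext (right p) w = right (ext p w)

lc : ∀ {t l r} → Pos t (node l r) → Pos t l
lc p = ext p (left here)

rc : ∀ {t l r} → Pos t (node l r) → Pos t r
rc p = ext p (right here)

depth : ∀ {t s} → Pos t s → ℕ
depth here      = zero
depth (left p)  = suc (depth p)
depth (right p) = suc (depth p)

_⊑_ : ∀ {t s u} → Pos t s → Pos t u → Set
_⊑_ {s = s} {u = u} p q = Σ (Pos s u) λ w → ext p w ≡ q

data Adj {t : BTree} : Node t → Node t → Set where
  down-l : ∀ {l r} (p : Pos t (node l r)) → Adj (_ , p) (_ , lc p)
  down-r : ∀ {l r} (p : Pos t (node l r)) → Adj (_ , p) (_ , rc p)
  up-l   : ∀ {l r} (p : Pos t (node l r)) → Adj (_ , lc p) (_ , p)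
  up-r   : ∀ {l r} (p : Pos t (node l r)) → Adj (_ , rc p) (_ , p)

data Connected {t : BTree} (P : Node t → Set) : Node t → Node t → Set where
  stop : ∀ {a} → P a → Connected P a a
  step : ∀ {a b c} → P a → Adj a b → Connected P b c → Connected P a c

Family : ℕ → Set₁
Family n = Subset n → Set

-- Rooted binary tree decomposition of the graph (Fin n , E), shape t, root = here.
record TreeDecomposition (n : ℕ) (E : Fin n → Fin n → Set) (t : BTree) : Set where
  field
    bag       : ∀ {s} → Pos t s → Subset n
    connected : ∀ (v : Fin n) (a b : Node t) →
                v ∈ bag (proj₂ a) → v ∈ bag (proj₂ b) →
                Connected (λ c → v ∈ bag (proj₂ c)) a b
    edges     : ∀ u v → E u v → Σ (Node t) λ a → u ∈ bag (proj₂ a) × v ∈ bag (proj₂ a)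

  InV : ∀ {s} → Pos t s → Fin n → Set
  InV p u = Σ (Node t) λ q → p ⊑ proj₂ q × u ∈ bag (proj₂ q)

  Highest : Fin n → Node t → Set
  Highest u a = u ∈ bag (proj₂ a) × (∀ (c : Node t) → u ∈ bag (proj₂ c) → depth (proj₂ a) ≤ depth (proj₂ c))

-- Data Σ_i (= Fin (k i)), H_{i,σ}, X_{i,σ}, F_{i,σ} with conditions (1)-(4).
record DPScheme {n : ℕ} {E : Fin n → Fin n → Set} {t : BTree}
                (TD : TreeDecomposition n E t) (C : Family n) : Set₁ where
  open TreeDecomposition TD
  field
    k   : ∀ {s} → Pos t s → ℕ
    H   : ∀ {s} (p : Pos t s) → Fin (k p) → Family n
    Xσ  : ∀ {s} (p : Pos t s) → Fin (k p) → Subset n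
    F   : ∀ {l r} (p : Pos t (node l r)) → Fin (k p) → Fin (k (lc p)) → Fin (k (rc p)) → Set
    H⊆V : ∀ {s} (p : Pos t s) σ S → H p σ S → ∀ u → u ∈ S → InV p u
    cond2 : ∀ {s} (p : Pos t s) σ S → H p σ S → S ∩ bag p ≡ Xσ p σ
    cond3 : ∀ {l r} (p : Pos t (node l r)) σ S →
            H p σ S ⇔ (∃ λ w → ∃ λ w' → ∃ λ Sj → ∃ λ Sj' →
                        F p σ w w' × H (lc p) w Sj × H (rc p) w' Sj' × S ≡ Xσ p σ ∪ Sj ∪ Sj')
    cond3-leaf : ∀ (p : Pos t leaf) σ →
                 (∀ S → H p σ S ⇔ S ≡ Xσ p σ) ⊎ (∀ S → ¬ H p σ S)
    cond4 : ∀ S → C S ⇔ ∃ λ σ → H here σ S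

module Submission where

open import Defs
open import Data.Nat using (ℕ; _≤_; _<_; z≤n; s≤s)
open import Data.Nat.Properties using (<⇒≱)
open import Data.Fin using (Fin)
open import Data.Fin.Subset using (Subset; _∈_; _⊆_; _∪_; _∩_)
open import Data.Fin.Subset.Properties using (p⊆p∪q; q⊆p∪q; x∈p∪q⁻; x∈p∩q⁺; x∈p∩q⁻)
open import Data.Product using (Σ; ∃; ∃₂; _×_; _,_; proj₁; proj₂)
open import Data.Sum using (_⊎_; inj₁; inj₂)
open import Data.Empty using (⊥-elim)
open import Function.Bundles using (_⇔_; Equivalence; mk⇔)
open import Relation.Binary.PropositionalEquality
  using (_≡_; refl; sym; trans; cong; subst; subst₂)

-- The certificate b is read off top-down: condition (4) gives a state at the root whose
-- family contains S, and condition (3) splits the witnessing set at each node into sets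
-- witnessing states of the two children.  Along the way each node i carries a set S_i (Sat i) with
-- S_i ∩ X_i = X_{i,b(i)} and S_i = X_{i,b(i)} ∪ S_j ∪ S_j', so S = S_r is the union of the
-- X_{i,b(i)}.  For the highest node ū of u, every bag containing u lies below ū (the bags
-- containing u form a subtree), so if u ∈ S then u ∈ S_ū ∩ X_ū = X_{ū,b(ū)}.

ext-here : ∀ {t s} (p : Pos t s) → ext p here ≡ p
ext-here here      = refl
ext-here (left p)  = cong left (ext-here p)
ext-here (right p) = cong right (ext-here p)

ext-assoc : ∀ {t s₀ s₁ s₂} (p : Pos t s₀) (w : Pos s₀ s₁) (v : Pos s₁ s₂) →
            ext (ext p w) v ≡ ext p (ext w v)
ext-assoc here      w v = refl
ext-assoc (left p)  w v = cong left (ext-assoc p w v)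
ext-assoc (right p) w v = cong right (ext-assoc p w v)

left-injective : ∀ {l r s} {p q : Pos l s} → left {r = r} p ≡ left q → p ≡ q
left-injective refl = refl

right-injective : ∀ {l r s} {p q : Pos r s} → right {l = l} p ≡ right q → p ≡ q
right-injective refl = refl

⊑-refl : ∀ {t s} (p : Pos t s) → p ⊑ p
⊑-refl p = here , ext-here p

⊑-ext : ∀ {t s s′ u} {a : Pos t s} {p : Pos t s′} (v : Pos s′ u) → a ⊑ p → a ⊑ ext p v
⊑-ext {a = a} v (w , e) = ext w v , trans (sym (ext-assoc a w v)) (cong (λ q → ext q v) e)

-- Two ancestors of a common node are comparable.
ancestor-or-shallower : ∀ {t s₀ s s′} (a : Pos t s₀) (w : Pos s₀ s) (y : Pos t s′) (v : Pos s′ s) →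
                        ext a w ≡ ext y v → depth y < depth a ⊎ a ⊑ y
ancestor-or-shallower here      w y         v e = inj₂ (y , refl)
ancestor-or-shallower (left a)  w here      v e = inj₁ (s≤s z≤n)
ancestor-or-shallower (right a) w here      v e = inj₁ (s≤s z≤n)
ancestor-or-shallower (left a)  w (right y) v ()
ancestor-or-shallower (right a) w (left y)  v ()
ancestor-or-shallower (left a)  w (left y)  v e
  with ancestor-or-shallower a w y v (left-injective e)
... | inj₁ lt      = inj₁ (s≤s lt)
... | inj₂ (w′ , e′) = inj₂ (w′ , cong left e′)
ancestor-or-shallower (right a) w (right y) v e
  with ancestor-or-shallower a w y v (right-injective e)
... | inj₁ lt      = inj₁ (s≤s lt)
... | inj₂ (w′ , e′) = inj₂ (w′ , cong right e′)

Connected-head : ∀ {t} {P : Node t → Set} {a c} → Connected P a c → P a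
Connected-head (stop pa)     = pa
Connected-head (step pa _ _) = pa

-- A walk through P cannot leave the subtree of a: climbing above a would pass through a
-- P-node shallower than a.
module _ {t s} {P : Node t → Set} (a : Pos t s)
         (minimal : ∀ c → P c → depth a ≤ depth (proj₂ c)) where

  private
    climb : ∀ {s′ u} (p : Pos t s′) (v : Pos s′ u) → a ⊑ ext p v → P (_ , p) → a ⊑ p
    climb p v (w , e) Pp with ancestor-or-shallower a w p v e
    ... | inj₁ lt  = ⊥-elim (<⇒≱ lt (minimal (_ , p) Pp))
    ... | inj₂ a⊑p = a⊑p

  minimal-depth⇒⊑ : ∀ {x c} → a ⊑ proj₂ x → Connected P x c → a ⊑ proj₂ c
  minimal-depth⇒⊑ a⊑x (stop _)                 = a⊑x
  minimal-depth⇒⊑ a⊑x (step _ (down-l p) rest) = minimal-depth⇒⊑ (⊑-ext (left here) a⊑x) rest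
  minimal-depth⇒⊑ a⊑x (step _ (down-r p) rest) = minimal-depth⇒⊑ (⊑-ext (right here) a⊑x) rest
  minimal-depth⇒⊑ a⊑x (step _ (up-l p) rest)   =
    minimal-depth⇒⊑ (climb p (left here) a⊑x (Connected-head rest)) rest
  minimal-depth⇒⊑ a⊑x (step _ (up-r p) rest)   =
    minimal-depth⇒⊑ (climb p (right here) a⊑x (Connected-head rest)) rest

-- Pos peels off its first step, which changes the ambient tree; Path peels off its last step,
-- so recursion from the root along Path is structural.
module TopDown {t : BTree} where

  data Path : BTree → Set where
    root : Path t
    toL  : ∀ {l r} → Path (node l r) → Path l
    toR  : ∀ {l r} → Path (node l r) → Path r

  pos : ∀ {s} → Path s → Pos t s
  pos root    = here
  pos (toL q) = lc (pos q)
  pos (toR q) = rc (pos q)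

  extPath : ∀ {s₀ s} → Path s₀ → Pos s₀ s → Path s
  extPath q here      = q
  extPath q (left w)  = extPath (toL q) w
  extPath q (right w) = extPath (toR q) w

  path : ∀ {s} → Pos t s → Path s
  path = extPath root

  pos-extPath : ∀ {s₀ s} (q : Path s₀) (w : Pos s₀ s) → pos (extPath q w) ≡ ext (pos q) w
  pos-extPath q here      = sym (ext-here (pos q))
  pos-extPath q (left w)  = trans (pos-extPath (toL q) w) (ext-assoc (pos q) (left here) w)
  pos-extPath q (right w) = trans (pos-extPath (toR q) w) (ext-assoc (pos q) (right here) w)

  extPath-ext : ∀ {s₀ s₁ s} (q : Path s₀) (w : Pos s₀ s₁) (v : Pos s₁ s) →
                extPath q (ext w v) ≡ extPath (extPath q w) v
  extPath-ext q here      v = refl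
  extPath-ext q (left w)  v = extPath-ext (toL q) w v
  extPath-ext q (right w) v = extPath-ext (toR q) w v

  pos-path : ∀ {s} (p : Pos t s) → pos (path p) ≡ p
  pos-path = pos-extPath root

  path-pos : ∀ {s} (q : Path s) → path (pos q) ≡ q
  path-pos root    = refl
  path-pos (toL q) = trans (extPath-ext root (pos q) (left here)) (cong toL (path-pos q))
  path-pos (toR q) = trans (extPath-ext root (pos q) (right here)) (cong toR (path-pos q))

  module Recursion (P : ∀ {s} → Pos t s → Set) (z : P here)
           (fl : ∀ {l r} (p : Pos t (node l r)) → P p → P (lc p))
           (fr : ∀ {l r} (p : Pos t (node l r)) → P p → P (rc p)) where

    private
      recPath : ∀ {s} (q : Path s) → P (pos q)
      recPath root    = z
      recPath (toL q) = fl (pos q) (recPath q)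
      recPath (toR q) = fr (pos q) (recPath q)

    rec : ∀ {s} (p : Pos t s) → P p
    rec p = subst P (pos-path p) (recPath (path p))

    private
      rec-pos : ∀ {s} (q : Path s) → rec (pos q) ≡ recPath q
      rec-pos q = transport-along (path (pos q)) (path-pos q) (pos-path (pos q))
        where
        transport-along : (q′ : Path _) → q′ ≡ q → (e : pos q′ ≡ pos q) →
                          subst P e (recPath q′) ≡ recPath q
        transport-along _ refl refl = refl

    rec-here : rec here ≡ z
    rec-here = rec-pos root

    rec-lc : ∀ {l r} (p : Pos t (node l r)) → rec (lc p) ≡ fl p (rec p)
    rec-lc p = subst (λ p → rec (lc p) ≡ fl p (rec p)) (pos-path p)
                     (trans (rec-pos (toL (path p))) (cong (fl _) (sym (rec-pos (path p)))))

    rec-rc : ∀ {l r} (p : Pos t (node l r)) → rec (rc p) ≡ fr p (rec p)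
    rec-rc p = subst (λ p → rec (rc p) ≡ fr p (rec p)) (pos-path p)
                     (trans (rec-pos (toR (path p))) (cong (fr _) (sym (rec-pos (path p)))))

module Certificate {n : ℕ} {E : Fin n → Fin n → Set} {t : BTree}
    (TD : TreeDecomposition n E t) (C : Family n) (D : DPScheme TD C)
    (S : Subset n) (CS : C S) where
  open TreeDecomposition TD
  open DPScheme D
  open Equivalence

  record Witness {s} (p : Pos t s) : Set where
    constructor witness
    field
      state    : Fin (k p)
      set      : Subset n
      realises : H p state set
  open Witness

  Splits : ∀ {l r} (p : Pos t (node l r)) → Witness p → Witness (lc p) → Witness (rc p) → Set
  Splits p w wl wr = F p (state w) (state wl) (state wr) × set w ≡ Xσ p (state w) ∪ set wl ∪ set wr

  split : ∀ {l r} (p : Pos t (node l r)) (w : Witness p) → ∃₂ (Splits p w)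
  split p (witness σ S h) with to (cond3 p σ S) h
  ... | wl , wr , Sl , Sr , f , hl , hr , e = witness wl Sl hl , witness wr Sr hr , f , e

  X⊆set∩bag : ∀ {s} (p : Pos t s) (w : Witness p) → Xσ p (state w) ⊆ set w ∩ bag p
  X⊆set∩bag p w = subst (_ ∈_) (sym (cond2 p (state w) (set w) (realises w)))

  set∩bag⊆X : ∀ {s} (p : Pos t s) (w : Witness p) {u} → u ∈ set w → u ∈ bag p → u ∈ Xσ p (state w)
  set∩bag⊆X p w u∈S u∈X = subst (_ ∈_) (cond2 p (state w) (set w) (realises w)) (x∈p∩q⁺ (u∈S , u∈X))

  root-witness : Witness here
  root-witness with to (cond4 S) CS
  ... | σ , h = witness σ S h

  open TopDown.Recursion Witness root-witness (λ p w → proj₁ (split p w))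
                                              (λ p w → proj₁ (proj₂ (split p w)))
    renaming (rec to certificate)

  certificate-root : set (certificate here) ≡ S
  certificate-root = cong set rec-here

  certificate-splits : ∀ {l r} (p : Pos t (node l r)) →
                       Splits p (certificate p) (certificate (lc p)) (certificate (rc p))
  certificate-splits p = subst₂ (Splits p (certificate p)) (sym (rec-lc p)) (sym (rec-rc p))
                                (proj₂ (proj₂ (split p (certificate p))))

  b : ∀ {s} (p : Pos t s) → Fin (k p)
  b p = state (certificate p)

  Sat : ∀ {s} → Pos t s → Subset n
  Sat p = set (certificate p)

  Sat-realises : ∀ {s} (p : Pos t s) → H p (b p) (Sat p)
  Sat-realises p = realises (certificate p)

  Sat-lc : ∀ {l r} (p : Pos t (node l r)) → Sat (lc p) ⊆ Sat p
  Sat-lc p u∈ = subst (_ ∈_) (sym (proj₂ (certificate-splits p))) (q⊆p∪q _ _ (p⊆p∪q _ u∈))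

  Sat-rc : ∀ {l r} (p : Pos t (node l r)) → Sat (rc p) ⊆ Sat p
  Sat-rc p u∈ = subst (_ ∈_) (sym (proj₂ (certificate-splits p))) (q⊆p∪q _ _ (q⊆p∪q _ _ u∈))

  Sat-antitone : ∀ {s₀ s} (a : Pos t s₀) (w : Pos s₀ s) → Sat (ext a w) ⊆ Sat a
  Sat-antitone a here      u∈ = subst (λ p → _ ∈ Sat p) (ext-here a) u∈
  Sat-antitone a (left w)  u∈ =
    Sat-lc a (Sat-antitone (lc a) w (subst (λ p → _ ∈ Sat p) (sym (ext-assoc a (left here) w)) u∈))
  Sat-antitone a (right w) u∈ =
    Sat-rc a (Sat-antitone (rc a) w (subst (λ p → _ ∈ Sat p) (sym (ext-assoc a (right here) w)) u∈))

  X⊆S : ∀ {s} (p : Pos t s) → Xσ p (b p) ⊆ S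
  X⊆S p u∈ = subst (_ ∈_) certificate-root
               (Sat-antitone here p (proj₁ (x∈p∩q⁻ _ _ (X⊆set∩bag p (certificate p) u∈))))

  Sat⊆⋃X : ∀ {u} s (p : Pos t s) → u ∈ Sat p → ∃ λ (c : Node t) → u ∈ Xσ (proj₂ c) (b (proj₂ c))
  Sat⊆⋃X leaf p u∈ with cond3-leaf p (b p)
  ... | inj₁ singleton = (_ , p) , subst (_ ∈_) (to (singleton (Sat p)) (Sat-realises p)) u∈
  ... | inj₂ empty     = ⊥-elim (empty (Sat p) (Sat-realises p))
  Sat⊆⋃X (node l r) p u∈ with x∈p∪q⁻ _ _ (subst (_ ∈_) (proj₂ (certificate-splits p)) u∈)
  ... | inj₁ u∈X = (_ , p) , u∈X
  ... | inj₂ u∈children with x∈p∪q⁻ _ _ u∈children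
  ...   | inj₁ u∈l = Sat⊆⋃X l (lc p) u∈l
  ...   | inj₂ u∈r = Sat⊆⋃X r (rc p) u∈r

  S⇔⋃X : ∀ u → (u ∈ S) ⇔ (∃ λ (a : Node t) → u ∈ Xσ (proj₂ a) (b (proj₂ a)))
  S⇔⋃X u = mk⇔ (λ u∈S → Sat⊆⋃X t here (subst (_ ∈_) (sym certificate-root) u∈S))
               (λ (a , u∈X) → X⊆S (proj₂ a) u∈X)

  S⇔X-highest : ∀ u (a : Node t) → Highest u a → (u ∈ S) ⇔ (u ∈ Xσ (proj₂ a) (b (proj₂ a)))
  S⇔X-highest u (_ , a) (u∈a , minimal) = mk⇔ to-X (X⊆S a)
    where
    to-X : u ∈ S → u ∈ Xσ a (b a)
    to-X u∈S with to (S⇔⋃X u) u∈S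
    ... | c , u∈Xc with x∈p∩q⁻ _ _ (X⊆set∩bag (proj₂ c) (certificate (proj₂ c)) u∈Xc)
    ... | u∈Sc , u∈c with minimal-depth⇒⊑ a minimal (⊑-refl a) (connected u (_ , a) c u∈a u∈c)
    ... | w , e = set∩bag⊆X a (certificate a)
                    (Sat-antitone a w (subst (λ p → u ∈ Sat p) (sym e) u∈Sc)) u∈a

claim1 : ∀ {n : ℕ} {E : Fin n → Fin n → Set} {t : BTree}
    (TD : TreeDecomposition n E t) (C : Family n) (D : DPScheme TD C) →
    ∀ (S : Subset n) → C S →
    Σ (∀ {s} (p : Pos t s) → Fin (DPScheme.k D p)) λ b →
    (∀ {l r} (p : Pos t (node l r)) → DPScheme.F D p (b p) (b (lc p)) (b (rc p)))
    × (∀ (p : Pos t leaf) → ∃ λ S′ → DPScheme.H D p (b p) S′)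
    × (∀ u → (u ∈ S) ⇔ (∃ λ (a : Node t) → u ∈ DPScheme.Xσ D (proj₂ a) (b (proj₂ a))))
    × (∀ u (a : Node t) → TreeDecomposition.Highest TD u a →
    (u ∈ S) ⇔ (u ∈ DPScheme.Xσ D (proj₂ a) (b (proj₂ a))))
claim1 TD C D S CS =
    b
  , (λ p → proj₁ (certificate-splits p))
  , (λ p → Sat p , Sat-realises p)
  , S⇔⋃X
  , S⇔X-highest
  where open Certificate TD C D S CS
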